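{- Let $L$ be a Latin square of even order $n$ that contains a subsquare $A$ of order $n/2$, and suppose that $A$ has a near-transversal. Then for every integer $\ell$ with $\frac n2<\ell\le\frac34 n$ and $\ell-\frac n2$ even, $L$ contains a maximal partial transversal of length $\ell$.
   Context: Latin squares are viewed as sets of triples $(r,c,s)$ with $s$ the symbol in cell $(r,c)$. A subsquare is a submatrix (a choice of rows and of columns) that is itself a Latin square. A partial transversal is a set of triples containing at most one triple in each row, at most one in each column, and at most one with each symbol; its length is its number of triples. It is maximal if not contained in a longer partial transversal. A near-transversal of a Latin square of order $k$ is a partial transversal of it of length $k-1$. -}

module Defs where

open import Data.Nat using (ℕ; _≤_; _<_; _+_; _*_)
open import Data.Fin using (Fin)
open import Data.Product using (Σ; _×_; _,_; proj₁; proj₂)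
open import Data.List using (List; length; map)
open import Data.List.Relation.Unary.Unique.Propositional using (Unique)
open import Data.List.Membership.Propositional using (_∈_)
open import Relation.Binary.PropositionalEquality using (_≡_)
open import Function.Definitions using (Injective)

-- A Latin square of order n on symbol set Fin n: L r c is the symbol in
-- cell (r , c); every row and every column contains each symbol at most
-- once (hence exactly once, by finiteness).
record LatinSquare (n : ℕ) : Set where
  field
    entry   : Fin n → Fin n → Fin n
    rowInj  : ∀ r → Injective _≡_ _≡_ (entry r)
    colInj  : ∀ c → Injective _≡_ _≡_ (λ r → entry r c)
open LatinSquare public

-- A subsquare of order m of L: a choice of m distinct rows and m distinct
-- columns such that the submatrix is itself a Latin square, i.e. it uses
-- exactly m symbols (given by an injective enumeration sym), each row and
-- column of the submatrix containing distinct symbols (inherited from L).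
record Subsquare {n : ℕ} (L : LatinSquare n) (m : ℕ) : Set where
  field
    rows    : Fin m → Fin n
    cols    : Fin m → Fin n
    sym     : Fin m → Fin n
    rowsInj : Injective _≡_ _≡_ rows
    colsInj : Injective _≡_ _≡_ cols
    symInj  : Injective _≡_ _≡_ sym
    closed  : ∀ i j → Σ (Fin m) λ s → entry L (rows i) (cols j) ≡ sym s
open Subsquare public

-- Its length is the
-- length of the list (distinct rows force distinct cells).
record IsPartialTransversal {k n : ℕ} (M : Fin k → Fin k → Fin n)
                            (T : List (Fin k × Fin k)) : Set where
  field
    rowsDistinct : Unique (map proj₁ T)
    colsDistinct : Unique (map proj₂ T)
    symsDistinct : Unique (map (λ p → M (proj₁ p) (proj₂ p)) T)
open IsPartialTransversal public

IsMaximalPartialTransversal : {k n : ℕ} (M : Fin k → Fin k → Fin n)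
                              (T : List (Fin k × Fin k)) → Set
IsMaximalPartialTransversal M T =
  IsPartialTransversal M T ×
  (∀ T' → IsPartialTransversal M T' → (∀ {x} → x ∈ T → x ∈ T') →
     length T' ≤ length T)

subArray : {n m : ℕ} {L : LatinSquare n} → Subsquare L m → Fin m → Fin m → Fin n
subArray {L = L} A i j = entry L (rows A i) (cols A j)

HasNearTransversal : {n k : ℕ} (M : Fin k → Fin k → Fin n) → Set
HasNearTransversal {k = k} M =
  Σ (List (Fin k × Fin k)) λ T → IsPartialTransversal M T × (length T + 1 ≡ k)

{-# OPTIONS --safe #-}
-- Write ℓ = h + 2s, so 1 ≤ s ≤ h/4. Cutting the near-transversal of A down to h − s cells
-- gives a partial transversal K inside A. Greedily add s cells in rows of A but outside its
-- columns, then s cells in columns of A but outside its rows, then s cells outside both that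
-- carry symbols of A; at step k at most 2s + 2k < h choices are forbidden, so there is always
-- room. The result has length (h − s) + 3s = ℓ and is maximal: K and the first batch use every
-- row of A, K and the second every column, K and the third every symbol of A, and a cell outside
-- the rows and columns of A carries a symbol of A, because its column already shows the h other
-- symbols in the rows of A.
module Submission where

open import Defs
open import Data.Nat using (ℕ; _≤_; _<_; _+_; _*_)
open import Data.Fin using (Fin)
open import Data.Product using (Σ; _×_)
open import Data.List using (List; length)
open import Relation.Binary.PropositionalEquality using (_≡_)

open import Data.Nat using (zero; suc; _∸_; z≤n; s≤s)
open import Data.Nat.Properties
open import Data.Nat.Tactic.RingSolver using (solve-∀)
open import Data.Fin using (zero; suc) renaming (_≟_ to _≟ᶠ_)
open import Data.Fin.Properties using (injective⇒≤; all?; ¬∀⟶∃¬)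
open import Data.Product using (∃; _,_; proj₁; proj₂)
open import Data.Sum using (_⊎_; inj₁; inj₂; [_,_]′)
open import Data.List using ([]; _∷_; map; _++_; drop; allFin; lookup)
open import Data.List.Properties using (length-map; length-++; length-drop; drop-map; map-++; map-∘; length-tabulate)
open import Data.List.Relation.Unary.All as All using (All; []; _∷_)
import Data.List.Relation.Unary.All.Properties as Allₚ
open import Data.List.Relation.Unary.Any as Any using (here; there; any?)
open import Data.List.Relation.Unary.Any.Properties using (lookup-index)
open import Data.List.Relation.Unary.AllPairs using (_∷_)
open import Data.List.Relation.Unary.Unique.Propositional using (Unique)
import Data.List.Relation.Unary.Unique.Propositional.Properties as Unique
open import Data.List.Membership.Propositional using (_∈_; _∉_)
open import Data.List.Membership.Propositional.Properties using (∈-map⁺; ∈-map⁻; ∈-++⁺ˡ; ∈-++⁺ʳ; ∈-++⁻; ∈-lookup; ∈-allFin)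
open import Data.List.Relation.Binary.Subset.Propositional using (_⊆_)
import Data.List.Relation.Binary.Subset.Propositional.Properties as Subset
open import Function using (_∘_; case_of_)
open import Function.Definitions using (Injective)
open import Relation.Binary.Definitions using (DecidableEquality)
open import Relation.Binary.PropositionalEquality using (refl; cong; cong₂; subst; subst₂; module ≡-Reasoning)
  renaming (sym to ≡-sym; trans to ≡-trans)
open import Relation.Nullary using (¬_; yes; no; contradiction)

module _ {X : Set} where

  Unique-∷ : ∀ {x : X} {xs} → x ∉ xs → Unique xs → Unique (x ∷ xs)
  Unique-∷ {xs = xs} x∉xs u = Allₚ.¬Any⇒All¬ xs x∉xs ∷ u

  Unique⇒lookup-injective : ∀ {xs : List X} → Unique xs → Injective _≡_ _≡_ (lookup xs)
  Unique⇒lookup-injective (_ ∷ _)     {zero}  {zero}  _ = refl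
  Unique⇒lookup-injective (x≢ ∷ _)    {zero}  {suc j} e = contradiction e (All.lookup x≢ (∈-lookup j))
  Unique⇒lookup-injective (x≢ ∷ _)    {suc i} {zero}  e = contradiction (≡-sym e) (All.lookup x≢ (∈-lookup i))
  Unique⇒lookup-injective (_ ∷ u)     {suc i} {suc j} e = cong suc (Unique⇒lookup-injective u e)

  Unique-⊆⇒length≤ : ∀ {xs ys : List X} → Unique xs → xs ⊆ ys → length xs ≤ length ys
  Unique-⊆⇒length≤ {xs} {ys} u xs⊆ys = injective⇒≤ position-injective
    where
    position : Fin (length xs) → Fin (length ys)
    position i = Any.index (xs⊆ys (∈-lookup i))

    lookup-position : ∀ i → lookup xs i ≡ lookup ys (position i)
    lookup-position i = lookup-index (xs⊆ys (∈-lookup i))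

    position-injective : Injective _≡_ _≡_ position
    position-injective {i} {j} e = Unique⇒lookup-injective u (begin
      lookup xs i             ≡⟨ lookup-position i ⟩
      lookup ys (position i)  ≡⟨ cong (lookup ys) e ⟩
      lookup ys (position j)  ≡⟨ lookup-position j ⟨
      lookup xs j             ∎)
      where open ≡-Reasoning

  Unique-⊆-length≥⇒⊇ : DecidableEquality X → ∀ {xs ys : List X} →
                       Unique xs → xs ⊆ ys → length ys ≤ length xs → ys ⊆ xs
  Unique-⊆-length≥⇒⊇ _≟_ {xs} {ys} u xs⊆ys ys≤xs {y} y∈ys with any? (y ≟_) xs
  ... | yes y∈xs = y∈xs
  ... | no  y∉xs = contradiction (≤-trans (Unique-⊆⇒length≤ (Unique-∷ y∉xs u) y∷xs⊆ys) ys≤xs) 1+n≰n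
    where
    y∷xs⊆ys : y ∷ xs ⊆ ys
    y∷xs⊆ys (here refl) = y∈ys
    y∷xs⊆ys (there p)   = xs⊆ys p

  Unique-map-injective : ∀ {Y : Set} {f : X → Y} {xs} {x y} →
                         Unique (map f xs) → x ∈ xs → y ∈ xs → f x ≡ f y → x ≡ y
  Unique-map-injective {xs = _ ∷ _} _        (here refl) (here refl) _ = refl
  Unique-map-injective {xs = _ ∷ _} (fx≢ ∷ _) (here refl) (there y∈) e = contradiction e (All.lookup fx≢ (∈-map⁺ _ y∈))
  Unique-map-injective {xs = _ ∷ _} (fy≢ ∷ _) (there x∈) (here refl) e = contradiction (≡-sym e) (All.lookup fy≢ (∈-map⁺ _ x∈))
  Unique-map-injective {xs = _ ∷ _} (_ ∷ u)   (there x∈) (there y∈) e = Unique-map-injective u x∈ y∈ e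

  Unique-map-drop-middle : ∀ {Y : Set} {f : X → Y} xs {ys zs} →
                           Unique (map f (xs ++ ys ++ zs)) → Unique (map f (xs ++ zs))
  Unique-map-drop-middle {f = f} [] {ys} u = drop-prefix ys u
    where
    drop-prefix : ∀ ys {zs} → Unique (map f (ys ++ zs)) → Unique (map f zs)
    drop-prefix []       u′      = u′
    drop-prefix (_ ∷ ys) (_ ∷ u′) = drop-prefix ys u′
  Unique-map-drop-middle {f = f} (x ∷ xs) {ys} {zs} (fx≢ ∷ u) =
    All.tabulate (All.lookup fx≢ ∘ Subset.map⁺ f shorter) ∷ Unique-map-drop-middle xs u
    where
    shorter : xs ++ zs ⊆ xs ++ ys ++ zs
    shorter = Subset.++⁺ʳ xs (Subset.xs⊆ys++xs zs ys)

  ∉-map-++⁺ : ∀ {Y : Set} {f : X → Y} xs {ys} {y} → y ∉ map f xs → y ∉ map f ys → y ∉ map f (xs ++ ys)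
  ∉-map-++⁺ {f = f} xs {ys} y∉xs y∉ys y∈ with ∈-++⁻ (map f xs) (subst (_ ∈_) (map-++ f xs ys) y∈)
  ... | inj₁ p = y∉xs p
  ... | inj₂ p = y∉ys p

  ∉-map-++⁻ : ∀ {Y : Set} {f : X → Y} xs {ys} {y} → y ∉ map f (xs ++ ys) → y ∉ map f xs × y ∉ map f ys
  ∉-map-++⁻ {f = f} xs {ys} y∉ =
    y∉ ∘ Subset.map⁺ f (Subset.xs⊆xs++ys xs ys) , y∉ ∘ Subset.map⁺ f (Subset.xs⊆ys++xs ys xs)

  ∉-map-via : ∀ {Y Z : Set} {f : X → Y} {g : X → Z} {a b} →
              (∀ {x} → f x ≡ a → g x ≡ b) → ∀ {xs} → b ∉ map g xs → a ∉ map f xs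
  ∉-map-via {g = g} transfer b∉ a∈ with ∈-map⁻ _ a∈
  ... | x , x∈ , a≡fx = b∉ (subst (_∈ map g _) (transfer (≡-sym a≡fx)) (∈-map⁺ g x∈))

  All∈⇒map⊆ : ∀ {Y : Set} {f : X → Y} {S xs} → All (λ x → f x ∈ S) xs → map f xs ⊆ S
  All∈⇒map⊆ all y∈ with ∈-map⁻ _ y∈
  ... | x , x∈ , refl = All.lookup all x∈

  All∈⇒∉-map : ∀ {Y : Set} {f : X → Y} {S xs a} → All (λ x → f x ∈ S) xs → a ∉ S → a ∉ map f xs
  All∈⇒∉-map all a∉S = a∉S ∘ All∈⇒map⊆ all

  All∉⇒∉-map : ∀ {Y : Set} {f : X → Y} {S xs a} → All (λ x → f x ∉ S) xs → a ∈ S → a ∉ map f xs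
  All∉⇒∉-map all a∈S a∈ with ∈-map⁻ _ a∈
  ... | x , x∈ , refl = All.lookup all x∈ a∈S

image : ∀ {k} {X : Set} → (Fin k → X) → List X
image {k} f = map f (allFin k)

module _ {k : ℕ} {X : Set} where

  length-image : (f : Fin k → X) → length (image f) ≡ k
  length-image f = ≡-trans (length-map f (allFin k)) (length-tabulate (λ i → i))

  ∈-image : (f : Fin k → X) → ∀ i → f i ∈ image f
  ∈-image f i = ∈-map⁺ f (∈-allFin i)

  ∈-image⁻ : ∀ {f : Fin k → X} {x} → x ∈ image f → ∃ λ i → x ≡ f i
  ∈-image⁻ x∈ with ∈-map⁻ _ x∈
  ... | i , _ , x≡fi = i , x≡fi

  Unique-image : ∀ {f : Fin k → X} → Injective _≡_ _≡_ f → Unique (image f)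
  Unique-image f-inj = Unique.map⁺ f-inj (Unique.allFin⁺ k)

  Unique-⊆-image⇒⊇ : DecidableEquality X → ∀ {f : Fin k → X} {xs} →
                     Unique xs → xs ⊆ image f → k ≤ length xs → image f ⊆ xs
  Unique-⊆-image⇒⊇ _≟_ {f} u xs⊆ k≤xs = Unique-⊆-length≥⇒⊇ _≟_ u xs⊆ (subst (_≤ _) (≡-sym (length-image f)) k≤xs)

  ∃-∉-image : DecidableEquality X → ∀ {f : Fin k → X} → Injective _≡_ _≡_ f →
              ∀ xs → length xs < k → ∃ λ i → f i ∉ xs
  ∃-∉-image _≟_ {f} f-inj xs short with all? (λ i → any? (f i ≟_) xs)
  ... | no  ¬all = ¬∀⟶∃¬ k _ (λ i → any? (f i ≟_) xs) ¬all
  ... | yes all  = contradiction (subst (_≤ length xs) (length-image f) image≤xs) (<⇒≱ short)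
    where
    image≤xs : length (image f) ≤ length xs
    image≤xs = Unique-⊆⇒length≤ (Unique-image f-inj) λ y∈ → case ∈-image⁻ y∈ of λ where
      (i , refl) → all i

∃-∉ : ∀ {n} (xs : List (Fin n)) → length xs < n → ∃ λ x → x ∉ xs
∃-∉ = ∃-∉-image _≟ᶠ_ (λ e → e)

Fin-injective⇒surjective : ∀ {n} {f : Fin n → Fin n} → Injective _≡_ _≡_ f → ∀ y → ∃ λ x → f x ≡ y
Fin-injective⇒surjective {n} {f} f-inj y
  with ∈-image⁻ (Unique-⊆-length≥⇒⊇ _≟ᶠ_ (Unique-image f-inj) (λ {x} _ → ∈-allFin x)
                   (≤-reflexive (≡-trans (length-tabulate (λ i → i)) (≡-sym (length-image f)))) (∈-allFin y))
... | x , y≡fx = x , ≡-sym y≡fx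

Cell : ℕ → Set
Cell k = Fin k × Fin k

module _ {k n : ℕ} (M : Fin k → Fin k → Fin n) where

  symbolAt : Cell k → Fin n
  symbolAt x = M (proj₁ x) (proj₂ x)

  Fits : List (Cell k) → Cell k → Set
  Fits T x = proj₁ x ∉ map proj₁ T × proj₂ x ∉ map proj₂ T × symbolAt x ∉ map symbolAt T

  Blocks : List (Cell k) → Cell k → Set
  Blocks T x = proj₁ x ∈ map proj₁ T ⊎ proj₂ x ∈ map proj₂ T ⊎ symbolAt x ∈ map symbolAt T

module _ {k n : ℕ} {M : Fin k → Fin k → Fin n} where

  ∷-isPartialTransversal : ∀ {T x} → Fits M T x → IsPartialTransversal M T → IsPartialTransversal M (x ∷ T)
  ∷-isPartialTransversal (row∉ , col∉ , sym∉) pt = record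
    { rowsDistinct = Unique-∷ row∉ (rowsDistinct pt)
    ; colsDistinct = Unique-∷ col∉ (colsDistinct pt)
    ; symsDistinct = Unique-∷ sym∉ (symsDistinct pt)
    }

  drop-isPartialTransversal : ∀ {T} i → IsPartialTransversal M T → IsPartialTransversal M (drop i T)
  drop-isPartialTransversal {T} i pt = record
    { rowsDistinct = dropped proj₁ (rowsDistinct pt)
    ; colsDistinct = dropped proj₂ (colsDistinct pt)
    ; symsDistinct = dropped (symbolAt M) (symsDistinct pt)
    }
    where
    dropped : ∀ {Y : Set} (f : Cell k → Y) → Unique (map f T) → Unique (map f (drop i T))
    dropped f u = subst Unique (drop-map i T) (Unique.drop⁺ i u)

  blocking⇒maximal : ∀ {T} → IsPartialTransversal M T → (∀ x → Blocks M T x) →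
                     IsMaximalPartialTransversal M T
  blocking⇒maximal {T} pt blocks = pt , longest
    where
    longest : ∀ T′ → IsPartialTransversal M T′ → T ⊆ T′ → length T′ ≤ length T
    longest T′ pt′ T⊆T′ = subst₂ _≤_ (length-map proj₁ T′) (length-map proj₁ T)
                            (Unique-⊆⇒length≤ (rowsDistinct pt′) (Subset.map⁺ proj₁ T′⊆T))
      where
      shares : ∀ {Y : Set} {f : Cell k → Y} {x} → Unique (map f T′) → x ∈ T′ → f x ∈ map f T → x ∈ T
      shares u x∈T′ fx∈ with ∈-map⁻ _ fx∈
      ... | y , y∈T , fx≡fy = subst (_∈ T) (≡-sym (Unique-map-injective u x∈T′ (T⊆T′ y∈T) fx≡fy)) y∈T

      T′⊆T : T′ ⊆ T
      T′⊆T {x} x∈T′ with blocks x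
      ... | inj₁ row∈        = shares (rowsDistinct pt′) x∈T′ row∈
      ... | inj₂ (inj₁ col∈) = shares (colsDistinct pt′) x∈T′ col∈
      ... | inj₂ (inj₂ sym∈) = shares (symsDistinct pt′) x∈T′ sym∈

  nearTransversal⇒partialTransversal : HasNearTransversal M → ∀ {q} → q < k →
                                       ∃ λ T → IsPartialTransversal M T × length T ≡ q
  nearTransversal⇒partialTransversal (N , pt , N+1≡k) {q} q<k =
    drop (length N ∸ q) N , drop-isPartialTransversal (length N ∸ q) pt ,
    ≡-trans (length-drop (length N ∸ q) N) (m∸[m∸n]≡n q≤N)
    where
    q≤N : q ≤ length N
    q≤N = m<1+n⇒m≤n (subst (q <_) (≡-trans (≡-sym N+1≡k) (+-comm (length N) 1)) q<k)

module _ {k n : ℕ} (M : Fin k → Fin k → Fin n) where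

  record Extension (Kind : Cell k → Set) (base : List (Cell k)) (size : ℕ) : Set where
    field
      new        : List (Cell k)
      length-new : length new ≡ size
      new-kinds  : All Kind new
      partial    : IsPartialTransversal M (new ++ base)

  extend : ∀ {Kind base} size →
           (∀ {j} → j < size → (E : Extension Kind base j) →
              Σ (Cell k) λ x → Kind x × Fits M (Extension.new E ++ base) x) →
           IsPartialTransversal M base → Extension Kind base size
  extend {Kind} {base} size next pt = grow size ≤-refl
    where
    grow : ∀ j → j ≤ size → Extension Kind base j
    grow zero    _      = record { new = [] ; length-new = refl ; new-kinds = [] ; partial = pt }
    grow (suc j) j<size with next j<size (grow j (<⇒≤ j<size))
    ... | x , kind , fits = record
      { new        = x ∷ new
      ; length-new = cong suc length-new
      ; new-kinds  = kind ∷ new-kinds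
      ; partial    = ∷-isPartialTransversal fits partial
      }
      where open Extension (grow j (<⇒≤ j<size))

module _ {m k n : ℕ} {M : Fin k → Fin k → Fin n} {ρ κ : Fin m → Fin k} where

  embed-isPartialTransversal : Injective _≡_ _≡_ ρ → Injective _≡_ _≡_ κ → ∀ {T} →
                               IsPartialTransversal (λ i j → M (ρ i) (κ j)) T →
                               IsPartialTransversal M (map (λ x → ρ (proj₁ x) , κ (proj₂ x)) T)
  embed-isPartialTransversal ρ-inj κ-inj {T} pt = record
    { rowsDistinct = subst Unique (≡-trans (≡-sym (map-∘ T)) (map-∘ T)) (Unique.map⁺ ρ-inj (rowsDistinct pt))
    ; colsDistinct = subst Unique (≡-trans (≡-sym (map-∘ T)) (map-∘ T)) (Unique.map⁺ κ-inj (colsDistinct pt))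
    ; symsDistinct = subst Unique (map-∘ T) (symsDistinct pt)
    }

transpose : ∀ {n} → LatinSquare n → LatinSquare n
transpose L = record { entry = λ r c → entry L c r ; rowInj = colInj L ; colInj = rowInj L }

transposeSubsquare : ∀ {n h} {L : LatinSquare n} → Subsquare L h → Subsquare (transpose L) h
transposeSubsquare A = record
  { rows = cols A ; cols = rows A ; sym = sym A
  ; rowsInj = colsInj A ; colsInj = rowsInj A ; symInj = symInj A
  ; closed = λ i j → closed A j i
  }

module _ {n : ℕ} (L : LatinSquare n) where

  colOf : Fin n → Fin n → Fin n
  colOf r s = proj₁ (Fin-injective⇒surjective (rowInj L r) s)

  entry-colOf : ∀ r s → entry L r (colOf r s) ≡ s
  entry-colOf r s = proj₂ (Fin-injective⇒surjective (rowInj L r) s)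

  colOf-entry : ∀ r c → colOf r (entry L r c) ≡ c
  colOf-entry r c = rowInj L r (entry-colOf r (entry L r c))

rowOf : ∀ {n} → LatinSquare n → Fin n → Fin n → Fin n
rowOf L = colOf (transpose L)

rowOf-entry : ∀ {n} (L : LatinSquare n) r c → rowOf L c (entry L r c) ≡ r
rowOf-entry L r c = colOf-entry (transpose L) c r

module _ {n h : ℕ} {L : LatinSquare n} (A : Subsquare L h) where

  rowsOf colsOf symsOf : List (Fin n)
  rowsOf = image (rows A)
  colsOf = image (cols A)
  symsOf = image (sym A)

  entry-inside : ∀ {r c} → r ∈ rowsOf → c ∈ colsOf → entry L r c ∈ symsOf
  entry-inside r∈ c∈ with ∈-image⁻ r∈ | ∈-image⁻ c∈
  ... | i , refl | j , refl = subst (_∈ symsOf) (≡-sym (proj₂ (closed A i j))) (∈-image (sym A) _)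

  symsOf⊆row : ∀ i → symsOf ⊆ image (λ j → entry L (rows A i) (cols A j))
  symsOf⊆row i = Unique-⊆-image⇒⊇ _≟ᶠ_ (Unique-image (colsInj A ∘ rowInj L (rows A i)))
    (λ e∈ → case ∈-image⁻ e∈ of λ where (j , refl) → entry-inside (∈-image (rows A) i) (∈-image (cols A) j))
    (≤-reflexive (≡-sym (length-image _)))

  entry-outside-cols : ∀ {r c} → r ∈ rowsOf → c ∉ colsOf → entry L r c ∉ symsOf
  entry-outside-cols {r} {c} r∈ c∉ e∈ with ∈-image⁻ r∈
  ... | i , refl with ∈-image⁻ (symsOf⊆row i e∈)
  ... | j , e≡ = c∉ (subst (_∈ colsOf) (≡-sym (rowInj L r e≡)) (∈-image (cols A) j))

  entry-opposite : n ≤ 2 * h → ∀ {r c} → r ∉ rowsOf → c ∉ colsOf → entry L r c ∈ symsOf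
  entry-opposite n≤2h {r} {c} r∉ c∉ with any? (entry L r c ≟ᶠ_) symsOf
  ... | yes e∈ = e∈
  ... | no  e∉ = contradiction (≤-trans too-many (≤-trans n≤2h (≤-reflexive (cong (h +_) (+-identityʳ h))))) 1+n≰n
    where
    column : List (Fin n)
    column = image (λ i → entry L (rows A i) c)

    e∉column : entry L r c ∉ column
    e∉column e∈ = case ∈-image⁻ e∈ of λ where
      (i , e≡) → r∉ (subst (_∈ rowsOf) (≡-sym (colInj L c e≡)) (∈-image (rows A) i))

    disjoint : ∀ {v} → ¬ (v ∈ symsOf × v ∈ column)
    disjoint (v∈syms , v∈column) = case ∈-image⁻ v∈column of λ where
      (i , refl) → entry-outside-cols (∈-image (rows A) i) c∉ v∈syms

    distinct : Unique (entry L r c ∷ symsOf ++ column)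
    distinct = Unique-∷ (λ p → [ e∉ , e∉column ]′ (∈-++⁻ symsOf p))
      (Unique.++⁺ (Unique-image (symInj A)) (Unique-image (rowsInj A ∘ colInj L c)) disjoint)

    too-many : suc (h + h) ≤ n
    too-many = subst₂ _≤_
      (cong suc (≡-trans (length-++ symsOf) (cong₂ _+_ (length-image (sym A)) (length-image _))))
      (length-tabulate (λ i → i))
      (Unique-⊆⇒length≤ distinct (λ {x} _ → ∈-allFin x))

entry-outside-rows : ∀ {n h} {L : LatinSquare n} (A : Subsquare L h) →
                     ∀ {r c} → r ∉ rowsOf A → c ∈ colsOf A → entry L r c ∉ symsOf A
entry-outside-rows A r∉ c∈ = entry-outside-cols (transposeSubsquare A) c∈ r∉

module _ {h : ℕ} {L : LatinSquare (2 * h)} (A : Subsquare L h) where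

  Inside RowOnly ColOnly Outside : Cell (2 * h) → Set
  Inside  x = proj₁ x ∈ rowsOf A × proj₂ x ∈ colsOf A
  RowOnly x = proj₁ x ∈ rowsOf A × proj₂ x ∉ colsOf A
  ColOnly x = proj₁ x ∉ rowsOf A × proj₂ x ∈ colsOf A
  Outside x = proj₁ x ∉ rowsOf A × proj₂ x ∉ colsOf A

  lift : Cell h → Cell (2 * h)
  lift x = rows A (proj₁ x) , cols A (proj₂ x)

  lift-inside : ∀ T → All Inside (map lift T)
  lift-inside T = Allₚ.map⁺ (All.universal (λ x → ∈-image (rows A) (proj₁ x) , ∈-image (cols A) (proj₂ x)) T)

  private
    symbol : Cell (2 * h) → Fin (2 * h)
    symbol = symbolAt (entry L)

    length-map-++ : ∀ {Y : Set} (f : Cell (2 * h) → Y) xs {ys} → length (map f (xs ++ ys)) ≡ length xs + length ys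
    length-map-++ f xs {ys} = ≡-trans (length-map f (xs ++ ys)) (length-++ xs)

    length-map₂ : ∀ {Y : Set} (f g : Cell (2 * h) → Y) xs ys →
                  length (map f xs ++ map g ys) ≡ length xs + length ys
    length-map₂ f g xs ys = ≡-trans (length-++ (map f xs)) (cong₂ _+_ (length-map f xs) (length-map g ys))

    ∃-∉-++ : (xs ys : List (Fin (2 * h))) → length xs ≡ h → length ys < h → ∃ λ x → x ∉ xs ++ ys
    ∃-∉-++ xs ys xs≡h ys<h = ∃-∉ (xs ++ ys) (begin-strict
      length (xs ++ ys)      ≡⟨ ≡-trans (length-++ xs) (cong (_+ length ys) xs≡h) ⟩
      h + length ys          <⟨ +-monoʳ-< h ys<h ⟩
      h + h                  ≡⟨ cong (h +_) (+-identityʳ h) ⟨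
      2 * h                  ∎)
      where open ≤-Reasoning

  module Construction (s q : ℕ) (s+q≡h : s + q ≡ h) (4s≤h : 4 * s ≤ h)
                      (K : List (Cell (2 * h))) (K-pt : IsPartialTransversal (entry L) K)
                      (K-length : length K ≡ q) (K-inside : All Inside K) where

    private
      Ext : (Cell (2 * h) → Set) → List (Cell (2 * h)) → ℕ → Set
      Ext = Extension (entry L)

      K-syms-inside : All (λ x → symbol x ∈ symsOf A) K
      K-syms-inside = All.map (λ (r∈ , c∈) → entry-inside A r∈ c∈) K-inside

      [s+k]+[s+k]<h : ∀ {k} → k < s → (s + k) + (s + k) < h
      [s+k]+[s+k]<h {k} k<s = begin-strict
        (s + k) + (s + k)  <⟨ +-mono-< (+-monoʳ-< s k<s) (+-monoʳ-< s k<s) ⟩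
        (s + s) + (s + s)  ≡⟨ double-double s ⟩
        4 * s              ≤⟨ 4s≤h ⟩
        h                  ∎
        where
        open ≤-Reasoning
        double-double : ∀ s → (s + s) + (s + s) ≡ 4 * s
        double-double = solve-∀

      k+[s+k]<h : ∀ {k} → k < s → k + (s + k) < h
      k+[s+k]<h {k} k<s = ≤-<-trans (m≤n+m (k + (s + k)) s) (subst (_< h) (+-assoc s k (s + k)) ([s+k]+[s+k]<h k<s))

      k+k<h : ∀ {k} → k < s → k + k < h
      k+k<h {k} k<s = ≤-<-trans (+-monoʳ-≤ k (m≤n+m k s)) (k+[s+k]<h k<s)

      k+q<h : ∀ {k} → k < s → k + q < h
      k+q<h {k} k<s = subst (k + q <_) s+q≡h (+-monoˡ-< q k<s)

      ∃-index-unused : ∀ {f : Fin h → Fin (2 * h)} → Injective _≡_ _≡_ f → ∀ {k} → k < s →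
                       (g : Cell (2 * h) → Fin (2 * h)) (xs : List (Cell (2 * h))) → length xs ≡ k →
                       ∃ λ i → f i ∉ map g (xs ++ K)
      ∃-index-unused f-inj k<s g xs xs≡k = ∃-∉-image _≟ᶠ_ f-inj (map g (xs ++ K))
        (subst (_< h) (≡-sym (≡-trans (length-map-++ g xs) (cong₂ _+_ xs≡k K-length))) (k+q<h k<s))

    next-rowOnly : ∀ {k} → k < s → (E : Ext RowOnly K k) →
                   Σ (Cell (2 * h)) λ x → RowOnly x × Fits (entry L) (Extension.new E ++ K) x
    next-rowOnly {k} k<s E = (r , c) , (r∈A , c∉A) , r∉used , c∉used , e∉used
      where
      open Extension E

      row-choice : ∃ λ i → rows A i ∉ map proj₁ (new ++ K)
      row-choice = ∃-index-unused (rowsInj A) k<s proj₁ new length-new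

      r : Fin (2 * h)
      r = rows A (proj₁ row-choice)

      r∈A : r ∈ rowsOf A
      r∈A = ∈-image (rows A) (proj₁ row-choice)

      r∉used : r ∉ map proj₁ (new ++ K)
      r∉used = proj₂ row-choice

      -- colOf L r inverts entry L r, so a column outside clash gives a symbol unused by new.
      clash : List (Fin (2 * h))
      clash = map proj₂ new ++ map (colOf L r ∘ symbol) new

      column-choice : ∃ λ c → c ∉ colsOf A ++ clash
      column-choice = ∃-∉-++ (colsOf A) clash (length-image (cols A))
        (subst (_< h) (≡-sym (≡-trans (length-map₂ proj₂ _ new new) (cong₂ _+_ length-new length-new))) (k+k<h k<s))

      c : Fin (2 * h)
      c = proj₁ column-choice

      c∉A : c ∉ colsOf A
      c∉A = proj₂ column-choice ∘ ∈-++⁺ˡ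

      c∉clash : c ∉ clash
      c∉clash = proj₂ column-choice ∘ ∈-++⁺ʳ (colsOf A)

      c∉used : c ∉ map proj₂ (new ++ K)
      c∉used = ∉-map-++⁺ new (c∉clash ∘ ∈-++⁺ˡ) (All∈⇒∉-map (All.map proj₂ K-inside) c∉A)

      e∉used : entry L r c ∉ map symbol (new ++ K)
      e∉used = ∉-map-++⁺ new
        (∉-map-via (λ e≡ → ≡-trans (cong (colOf L r) e≡) (colOf-entry L r c)) (c∉clash ∘ ∈-++⁺ʳ (map proj₂ new)))
        (All∈⇒∉-map K-syms-inside (entry-outside-cols A r∈A c∉A))

    -- Opaque so that checking the later phases does not unfold the earlier greedy choices.
    opaque
      rowOnly : Ext RowOnly K s
      rowOnly = extend (entry L) s next-rowOnly K-pt

    B : List (Cell (2 * h))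
    B = Extension.new rowOnly

    next-colOnly : ∀ {k} → k < s → (E : Ext ColOnly (B ++ K) k) →
                   Σ (Cell (2 * h)) λ x → ColOnly x × Fits (entry L) (Extension.new E ++ B ++ K) x
    next-colOnly {k} k<s E = (r , c) , (r∉A , c∈A) , r∉used , c∉used , e∉used
      where
      open Extension E

      column-choice : ∃ λ j → cols A j ∉ map proj₂ (new ++ K)
      column-choice = ∃-index-unused (colsInj A) k<s proj₂ new length-new

      c : Fin (2 * h)
      c = cols A (proj₁ column-choice)

      c∈A : c ∈ colsOf A
      c∈A = ∈-image (cols A) (proj₁ column-choice)

      clash : List (Fin (2 * h))
      clash = map proj₁ new ++ map (rowOf L c ∘ symbol) (B ++ new)

      row-choice : ∃ λ r → r ∉ rowsOf A ++ clash
      row-choice = ∃-∉-++ (rowsOf A) clash (length-image (rows A))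
        (subst (_< h) (≡-sym (≡-trans (length-map₂ proj₁ _ new (B ++ new))
                               (cong₂ _+_ length-new (≡-trans (length-++ B) (cong₂ _+_ (Extension.length-new rowOnly) length-new)))))
          (k+[s+k]<h k<s))

      r : Fin (2 * h)
      r = proj₁ row-choice

      r∉A : r ∉ rowsOf A
      r∉A = proj₂ row-choice ∘ ∈-++⁺ˡ

      r∉clash : r ∉ clash
      r∉clash = proj₂ row-choice ∘ ∈-++⁺ʳ (rowsOf A)

      r∉used : r ∉ map proj₁ (new ++ B ++ K)
      r∉used = ∉-map-++⁺ new (r∉clash ∘ ∈-++⁺ˡ) (∉-map-++⁺ B
        (All∈⇒∉-map (All.map proj₁ (Extension.new-kinds rowOnly)) r∉A)
        (All∈⇒∉-map (All.map proj₁ K-inside) r∉A))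

      c∉used : c ∉ map proj₂ (new ++ B ++ K)
      c∉used = ∉-map-++⁺ new (proj₁ (∉-map-++⁻ new (proj₂ column-choice))) (∉-map-++⁺ B
        (All∉⇒∉-map (All.map proj₂ (Extension.new-kinds rowOnly)) c∈A)
        (proj₂ (∉-map-++⁻ new (proj₂ column-choice))))

      e∉B++new : entry L r c ∉ map symbol (B ++ new)
      e∉B++new = ∉-map-via (λ e≡ → ≡-trans (cong (rowOf L c) e≡) (rowOf-entry L r c))
        (r∉clash ∘ ∈-++⁺ʳ (map proj₁ new))

      e∉used : entry L r c ∉ map symbol (new ++ B ++ K)
      e∉used = ∉-map-++⁺ new (proj₂ (∉-map-++⁻ B e∉B++new)) (∉-map-++⁺ B
        (proj₁ (∉-map-++⁻ B e∉B++new))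
        (All∈⇒∉-map K-syms-inside (entry-outside-rows A r∉A c∈A)))

    opaque
      colOnly : Ext ColOnly (B ++ K) s
      colOnly = extend (entry L) s next-colOnly (Extension.partial rowOnly)

    C : List (Cell (2 * h))
    C = Extension.new colOnly

    next-outside : ∀ {k} → k < s → (E : Ext Outside (C ++ B ++ K) k) →
                   Σ (Cell (2 * h)) λ x → Outside x × Fits (entry L) (Extension.new E ++ C ++ B ++ K) x
    next-outside {k} k<s E = (r , c) , (r∉A , c∉A) , r∉used , c∉used , e∉used
      where
      open Extension E

      symbol-choice : ∃ λ σ → sym A σ ∉ map symbol (new ++ K)
      symbol-choice = ∃-index-unused (symInj A) k<s symbol new length-new

      v : Fin (2 * h)
      v = sym A (proj₁ symbol-choice)

      v∈A : v ∈ symsOf A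
      v∈A = ∈-image (sym A) (proj₁ symbol-choice)

      -- Avoiding the rows that hold v in the columns of B ++ new keeps colOf L r v off those columns.
      clash : List (Fin (2 * h))
      clash = map proj₁ (C ++ new) ++ map (λ x → rowOf L (proj₂ x) v) (B ++ new)

      row-choice : ∃ λ r → r ∉ rowsOf A ++ clash
      row-choice = ∃-∉-++ (rowsOf A) clash (length-image (rows A))
        (subst (_< h) (≡-sym (≡-trans (length-map₂ proj₁ _ (C ++ new) (B ++ new))
                               (cong₂ _+_ (phase-length colOnly) (phase-length rowOnly))))
          ([s+k]+[s+k]<h k<s))
        where
        phase-length : ∀ {Kind base} (P : Ext Kind base s) → length (Extension.new P ++ new) ≡ s + k
        phase-length P = ≡-trans (length-++ (Extension.new P)) (cong₂ _+_ (Extension.length-new P) length-new)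

      r : Fin (2 * h)
      r = proj₁ row-choice

      r∉A : r ∉ rowsOf A
      r∉A = proj₂ row-choice ∘ ∈-++⁺ˡ

      r∉clash : r ∉ clash
      r∉clash = proj₂ row-choice ∘ ∈-++⁺ʳ (rowsOf A)

      c : Fin (2 * h)
      c = colOf L r v

      e≡v : entry L r c ≡ v
      e≡v = entry-colOf L r v

      c∉A : c ∉ colsOf A
      c∉A c∈A = entry-outside-rows A r∉A c∈A (subst (_∈ symsOf A) (≡-sym e≡v) v∈A)

      r∉used : r ∉ map proj₁ (new ++ C ++ B ++ K)
      r∉used = ∉-map-++⁺ new (proj₂ r∉C++new) (∉-map-++⁺ C (proj₁ r∉C++new) (∉-map-++⁺ B
        (All∈⇒∉-map (All.map proj₁ (Extension.new-kinds rowOnly)) r∉A)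
        (All∈⇒∉-map (All.map proj₁ K-inside) r∉A)))
        where
        r∉C++new : r ∉ map proj₁ C × r ∉ map proj₁ new
        r∉C++new = ∉-map-++⁻ C (r∉clash ∘ ∈-++⁺ˡ)

      c∉used : c ∉ map proj₂ (new ++ C ++ B ++ K)
      c∉used = ∉-map-++⁺ new (proj₂ c∉B++new) (∉-map-++⁺ C
        (All∈⇒∉-map (All.map proj₂ (Extension.new-kinds colOnly)) c∉A) (∉-map-++⁺ B
        (proj₁ c∉B++new)
        (All∈⇒∉-map (All.map proj₂ K-inside) c∉A)))
        where
        r-of-c : rowOf L c v ≡ r
        r-of-c = ≡-trans (cong (rowOf L c) (≡-sym e≡v)) (rowOf-entry L r c)

        c∉B++new : c ∉ map proj₂ B × c ∉ map proj₂ new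
        c∉B++new = ∉-map-++⁻ B (∉-map-via (λ c′≡c → ≡-trans (cong (λ c′ → rowOf L c′ v) c′≡c) r-of-c)
                                    (r∉clash ∘ ∈-++⁺ʳ (map proj₁ (C ++ new))))

      e∉used : entry L r c ∉ map symbol (new ++ C ++ B ++ K)
      e∉used = subst (_∉ map symbol (new ++ C ++ B ++ K)) (≡-sym e≡v) (∉-map-++⁺ new (proj₁ v∉new++K) (∉-map-++⁺ C
        (All∉⇒∉-map (All.map (λ (r∉ , c∈) → entry-outside-rows A r∉ c∈) (Extension.new-kinds colOnly)) v∈A) (∉-map-++⁺ B
        (All∉⇒∉-map (All.map (λ (r∈ , c∉) → entry-outside-cols A r∈ c∉) (Extension.new-kinds rowOnly)) v∈A)
        (proj₂ v∉new++K))))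
        where
        v∉new++K : v ∉ map symbol new × v ∉ map symbol K
        v∉new++K = ∉-map-++⁻ new (proj₂ symbol-choice)

    opaque
      outside : Ext Outside (C ++ B ++ K) s
      outside = extend (entry L) s next-outside (Extension.partial colOnly)

    D : List (Cell (2 * h))
    D = Extension.new outside

    T : List (Cell (2 * h))
    T = D ++ C ++ B ++ K

    T-isPartialTransversal : IsPartialTransversal (entry L) T
    T-isPartialTransversal = Extension.partial outside

    length-T : length T ≡ s + (s + (s + q))
    length-T = ≡-trans (length-++ D) (cong₂ _+_ (Extension.length-new outside)
                 (≡-trans (length-++ C) (cong₂ _+_ (Extension.length-new colOnly)
                   (≡-trans (length-++ B) (cong₂ _+_ (Extension.length-new rowOnly) K-length)))))

    private
      phase++K-covers : ∀ {Kind base} (P : Ext Kind base s) (f : Cell (2 * h) → Fin (2 * h)) {g : Fin h → Fin (2 * h)} →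
                        Unique (map f (Extension.new P ++ K)) →
                        (∀ {x} → Kind x → f x ∈ image g) → (∀ {x} → Inside x → f x ∈ image g) →
                        image g ⊆ map f (Extension.new P ++ K)
      phase++K-covers P f u kind⇒∈ inside⇒∈ = Unique-⊆-image⇒⊇ _≟ᶠ_ u
        (All∈⇒map⊆ (Allₚ.++⁺ (All.map kind⇒∈ (Extension.new-kinds P)) (All.map inside⇒∈ K-inside)))
        (≤-reflexive (≡-trans (≡-sym s+q≡h) (≡-sym (≡-trans (length-map-++ f (Extension.new P))
                                                            (cong₂ _+_ (Extension.length-new P) K-length)))))

      rows-covered : rowsOf A ⊆ map proj₁ T
      rows-covered = Subset.map⁺ proj₁ (Subset.xs⊆ys++xs (C ++ B ++ K) D ∘ Subset.xs⊆ys++xs (B ++ K) C)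
                   ∘ phase++K-covers rowOnly proj₁ (rowsDistinct (Extension.partial rowOnly)) proj₁ proj₁

      cols-covered : colsOf A ⊆ map proj₂ T
      cols-covered = Subset.map⁺ proj₂ (Subset.xs⊆ys++xs (C ++ B ++ K) D ∘ Subset.++⁺ʳ C (Subset.xs⊆ys++xs K B))
                   ∘ phase++K-covers colOnly proj₂ (Unique-map-drop-middle C (colsDistinct (Extension.partial colOnly))) proj₂ proj₂

      syms-covered : symsOf A ⊆ map symbol T
      syms-covered = Subset.map⁺ symbol (Subset.++⁺ʳ D (Subset.xs⊆ys++xs (B ++ K) C ∘ Subset.xs⊆ys++xs K B))
                   ∘ phase++K-covers outside symbol
                       (Unique-map-drop-middle D {B} (Unique-map-drop-middle D {C} (symsDistinct T-isPartialTransversal)))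
                       (λ (r∉ , c∉) → entry-opposite A ≤-refl r∉ c∉)
                       (λ (r∈ , c∈) → entry-inside A r∈ c∈)

    T-blocks : ∀ x → Blocks (entry L) T x
    T-blocks (r , c) with any? (r ≟ᶠ_) (rowsOf A) | any? (c ≟ᶠ_) (colsOf A)
    ... | yes r∈A | _       = inj₁ (rows-covered r∈A)
    ... | no  _   | yes c∈A = inj₂ (inj₁ (cols-covered c∈A))
    ... | no  r∉A | no  c∉A = inj₂ (inj₂ (syms-covered (entry-opposite A ≤-refl r∉A c∉A)))

quarter-bound : ∀ h t → 4 * (h + 2 * t) ≤ 3 * (2 * h) → 4 * t ≤ h
quarter-bound h t 4ℓ≤6h = *-cancelˡ-≤ 2 (+-cancelˡ-≤ (4 * h) _ _ (subst₂ _≤_ (expand-4ℓ h t) (expand-6h h) 4ℓ≤6h))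
  where
  expand-4ℓ : ∀ h t → 4 * (h + 2 * t) ≡ 4 * h + 2 * (4 * t)
  expand-4ℓ = solve-∀
  expand-6h : ∀ h → 3 * (2 * h) ≡ 4 * h + 2 * h
  expand-6h = solve-∀

theorem5p6 : (h : ℕ) (L : LatinSquare (2 * h)) (A : Subsquare L h) →
    HasNearTransversal (subArray A) →
    (ℓ t : ℕ) → ℓ ≡ h + 2 * t → h < ℓ → 4 * ℓ ≤ 3 * (2 * h) →
    Σ (List (Fin (2 * h) × Fin (2 * h))) λ T →
    IsMaximalPartialTransversal (entry L) T × length T ≡ ℓ
theorem5p6 h L A near ℓ zero ℓ≡h+0 h<ℓ _ = contradiction (≡-trans ℓ≡h+0 (+-identityʳ h)) (>⇒≢ h<ℓ)
theorem5p6 h L A near ℓ t@(suc _) ℓ≡h+2t h<ℓ 4ℓ≤6h =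
  T , blocking⇒maximal T-isPartialTransversal T-blocks , length-T≡ℓ
  where
  4t≤h : 4 * t ≤ h
  4t≤h = quarter-bound h t (subst (λ ℓ → 4 * ℓ ≤ 3 * (2 * h)) ℓ≡h+2t 4ℓ≤6h)

  t≤h : t ≤ h
  t≤h = ≤-trans (m≤m+n t (3 * t)) 4t≤h

  t+q≡h : t + (h ∸ t) ≡ h
  t+q≡h = m+[n∸m]≡n t≤h

  shortened : ∃ λ N → IsPartialTransversal (subArray A) N × length N ≡ h ∸ t
  shortened = nearTransversal⇒partialTransversal near (∸-monoʳ-< {o = 0} (s≤s z≤n) t≤h)

  K : List (Cell (2 * h))
  K = map (lift A) (proj₁ shortened)

  open Construction A t (h ∸ t) t+q≡h 4t≤h K
    (embed-isPartialTransversal (rowsInj A) (colsInj A) (proj₁ (proj₂ shortened)))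
    (≡-trans (length-map (lift A) (proj₁ shortened)) (proj₂ (proj₂ shortened)))
    (lift-inside A (proj₁ shortened))

  length-T≡ℓ : length T ≡ ℓ
  length-T≡ℓ = begin
    length T                   ≡⟨ length-T ⟩
    t + (t + (t + (h ∸ t)))    ≡⟨ thrice t (h ∸ t) ⟩
    (t + (h ∸ t)) + 2 * t      ≡⟨ cong (_+ 2 * t) t+q≡h ⟩
    h + 2 * t                  ≡⟨ ℓ≡h+2t ⟨
    ℓ                          ∎
    where
    open ≡-Reasoning
    thrice : ∀ t q → t + (t + (t + q)) ≡ (t + q) + 2 * t
    thrice = solve-∀
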